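{- For every context $\Gamma$, terms $M,N,A,B$ and variable $x$: if $\Gamma,x:A\vdash M:B$ and $\Gamma\vdash N:A$, then $\Gamma\vdash M[x:=N]:B[x:=N]$.
   Context: Variables $\mathcal{V}$: a type with decidable equality and maps $\mathrm{encode}:\mathcal{V}\to\mathbb{N}$, $\mathrm{decode}:\mathbb{N}\to\mathcal{V}$ with $\mathrm{encode}(\mathrm{decode}\,n)=n$. Constants $\mathcal{C}$: any type. Terms: $\mathsf{c}\,k$, $\mathsf{v}\,x$, $\lambda[x:A]M$, $\Pi[x:A]B$, $M\cdot N$. Free-variable list: $\mathrm{fv}(\mathsf{c}\,k)=[\,]$, $\mathrm{fv}(\mathsf{v}\,x)=[x]$, $\mathrm{fv}(\lambda[x:A]M)=\mathrm{fv}\,A\mathbin{++}(\mathrm{fv}\,M-x)$, likewise $\Pi$, $\mathrm{fv}(M\cdot N)=\mathrm{fv}\,M\mathbin{++}\mathrm{fv}\,N$ ($xs-x$ removes all occurrences of $x$). Substitutions $\sigma:\mathcal{V}\to\Lambda$; $\iota\,x=\mathsf{v}\,x$; $(\sigma,x:=N)$ sends $x$ to $N$, $y\neq x$ to $\sigma\,y$. Fix $\chi':\mathrm{List}\,\mathbb{N}\to\mathbb{N}$ with $\chi'(ns)\notin ns$; $X'(xs)=\mathrm{decode}(\chi'(\mathrm{map\ encode}\ xs))$; $X(\sigma,xs)=X'$(concatenation of $\mathrm{fv}(\sigma\,y)$ for $y$ in $xs$). Substitution: $\mathsf{c}\,k\bullet\sigma=\mathsf{c}\,k$, $\mathsf{v}\,x\bullet\sigma=\sigma\,x$,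 $(M\cdot N)\bullet\sigma=(M\bullet\sigma)\cdot(N\bullet\sigma)$, $(\lambda[x:A]M)\bullet\sigma=\lambda[y:A\bullet\sigma](M\bullet(\sigma,x:=\mathsf{v}\,y))$ with $y=X(\sigma,\mathrm{fv}\,M-x)$, analogously for $\Pi$ (with $y=X(\sigma,\mathrm{fv}\,B-x)$). $M[x:=N]=M\bullet(\iota,x:=N)$. Alpha-conversion $\sim_\alpha$: inductive, $\mathsf{c}\,k\sim_\alpha\mathsf{c}\,k$, $\mathsf{v}\,x\sim_\alpha\mathsf{v}\,x$, congruence for application, and $\lambda[x:A]M\sim_\alpha\lambda[x':A']M'$ whenever $A\sim_\alpha A'$, $y\notin\mathrm{fv}\,M-x$, $y\notin\mathrm{fv}\,M'-x'$ and $M[x:=\mathsf{v}\,y]=M'[x':=\mathsf{v}\,y]$ syntactically, for some $y$ (same for $\Pi$). Beta: the contextual closure of a relation $S$ is the least relation containing $S$ and closed under rewriting in the body or annotation of $\lambda$, in the codomain or domain of $\Pi$, and in either side of an application; $\to_\beta$ is the contextual closure of $(\lambda[x:A]M)\cdot N\ \triangleright\ M[x:=N]$; $\simeq_\beta$ is the reflexive–symmetric–transitive closure of $\sim_\alpha\cup\to_\beta$. PTS: fix $\mathcal{A}\subseteq\mathcal{C}^2$ (axioms) and $\mathcal{R}\subseteq\mathcal{C}^3$ (rules). A context is a list of pairs $(x,A)$; $\Gamma,x:A$ denotes $(x,A)::\Gamma$; $\mathrm{dom}\,\Gamma$ is the list of first components. The judgments $\Gamma\ \mathrm{ok}$ and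 $\Gamma\vdash M:A$ are mutually inductively defined by: (nil) $[\,]\ \mathrm{ok}$; (cons) if $\Gamma\ \mathrm{ok}$, $\Gamma\vdash A:\mathsf{c}\,s$ and $x\notin\mathrm{dom}\,\Gamma$ then $(\Gamma,x:A)\ \mathrm{ok}$; (sort) if $\Gamma\ \mathrm{ok}$ and $\mathcal{A}\,s_1\,s_2$ then $\Gamma\vdash\mathsf{c}\,s_1:\mathsf{c}\,s_2$; (prod) if $\Gamma\vdash A:\mathsf{c}\,s_1$, for every $y\notin\mathrm{dom}\,\Gamma$ we have $\Gamma,y:A\vdash B[x:=\mathsf{v}\,y]:\mathsf{c}\,s_2$, and $\mathcal{R}\,s_1\,s_2\,s_3$, then $\Gamma\vdash\Pi[x:A]B:\mathsf{c}\,s_3$; (var) if $\Gamma\ \mathrm{ok}$ and $(x,A)\in\Gamma$ then $\Gamma\vdash\mathsf{v}\,x:A$; (abs) if $\Gamma\vdash A:\mathsf{c}\,s_1$, for every $z\notin\mathrm{dom}\,\Gamma$ both $\Gamma,z:A\vdash B[y:=\mathsf{v}\,z]:\mathsf{c}\,s_2$ and $\Gamma,z:A\vdash M[x:=\mathsf{v}\,z]:B[y:=\mathsf{v}\,z]$, and $\mathcal{R}\,s_1\,s_2\,s_3$, then $\Gamma\vdash\lambda[x:A]M:\Pi[y:A]B$; (app) if $\Gamma\vdash M:\Pi[x:A]B$, $\Gamma\vdash N:A$ and $\Gamma\vdash B[x:=N]:\mathsf{c}\,s$, then $\Gamma\vdash M\cdot N:B[x:=N]$; (conv) if $\Gamma\vdash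 M:A$, $A\simeq_\beta B$ and $\Gamma\vdash B:\mathsf{c}\,s$ then $\Gamma\vdash M:B$. -}

module Defs where

open import Data.Nat using (ℕ)
open import Data.List using (List; []; _∷_; _++_; map; filter; concatMap)
open import Data.List.Membership.Propositional using (_∈_; _∉_)
open import Data.Product using (_×_; _,_)
open import Relation.Nullary using (¬_; ¬?)
open import Relation.Nullary.Decidable using (yes; no)
open import Relation.Binary.Definitions using (DecidableEquality)
open import Relation.Binary.PropositionalEquality using (_≡_)
open import Relation.Binary.Construct.Closure.Equivalence using (EqClosure)

record Setup : Set₁ where
  field
    𝒱 : Set
    _≟_ : DecidableEquality 𝒱
    encode : 𝒱 → ℕ
    decode : ℕ → 𝒱
    encode-decode : ∀ n → encode (decode n) ≡ n
    𝒞 : Set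
    χ′ : List ℕ → ℕ
    χ′-fresh : ∀ ns → χ′ ns ∉ ns
    𝒜 : 𝒞 → 𝒞 → Set
    ℛ : 𝒞 → 𝒞 → 𝒞 → Set

module PTS (S : Setup) where
  open Setup S

  infixl 7 _·_
  infix 8 _[_≔_]
  infix 8 _•_
  infix 4 _⊢_∶_
  infix 4 _∼α_ _≃β_ _→β_ _▷β_
  infixl 5 _,,_∶_
  data Λ : Set where
    c   : 𝒞 → Λ
    v   : 𝒱 → Λ
    ƛ[_∶_]_ : 𝒱 → Λ → Λ → Λ
    Π[_∶_]_ : 𝒱 → Λ → Λ → Λ
    _·_ : Λ → Λ → Λ

  _-_ : List 𝒱 → 𝒱 → List 𝒱
  xs - x = filter (λ y → ¬? (y ≟ x)) xs

  fv : Λ → List 𝒱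
  fv (c k) = []
  fv (v x) = x ∷ []
  fv (ƛ[ x ∶ A ] M) = fv A ++ (fv M - x)
  fv (Π[ x ∶ A ] B) = fv A ++ (fv B - x)
  fv (M · N) = fv M ++ fv N

  Σ′ : Set
  Σ′ = 𝒱 → Λ

  ι : Σ′
  ι x = v x

  _,_≔_ : Σ′ → 𝒱 → Λ → Σ′
  (σ , x ≔ N) y with y ≟ x
  ... | yes _ = N
  ... | no  _ = σ y

  X′ : List 𝒱 → 𝒱
  X′ xs = decode (χ′ (map encode xs))

  X : Σ′ → List 𝒱 → 𝒱
  X σ xs = X′ (concatMap (λ y → fv (σ y)) xs)

  _•_ : Λ → Σ′ → Λ
  c k • σ = c k
  v x • σ = σ x
  (M · N) • σ = (M • σ) · (N • σ)
  (ƛ[ x ∶ A ] M) • σ =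
    let y = X σ (fv M - x) in ƛ[ y ∶ A • σ ] (M • (σ , x ≔ v y))
  (Π[ x ∶ A ] B) • σ =
    let y = X σ (fv B - x) in Π[ y ∶ A • σ ] (B • (σ , x ≔ v y))

  _[_≔_] : Λ → 𝒱 → Λ → Λ
  M [ x ≔ N ] = M • (ι , x ≔ N)

  data _∼α_ : Λ → Λ → Set where
    ∼c : ∀ {k} → c k ∼α c k
    ∼v : ∀ {x} → v x ∼α v x
    ∼· : ∀ {M M′ N N′} → M ∼α M′ → N ∼α N′ → (M · N) ∼α (M′ · N′)
    ∼ƛ : ∀ {x x′ A A′ M M′} y → A ∼α A′ → y ∉ (fv M - x) → y ∉ (fv M′ - x′)
       → M [ x ≔ v y ] ≡ M′ [ x′ ≔ v y ] → (ƛ[ x ∶ A ] M) ∼α (ƛ[ x′ ∶ A′ ] M′)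
    ∼Π : ∀ {x x′ A A′ B B′} y → A ∼α A′ → y ∉ (fv B - x) → y ∉ (fv B′ - x′)
       → B [ x ≔ v y ] ≡ B′ [ x′ ≔ v y ] → (Π[ x ∶ A ] B) ∼α (Π[ x′ ∶ A′ ] B′)

  data Ctx (R : Λ → Λ → Set) : Λ → Λ → Set where
    base : ∀ {M N} → R M N → Ctx R M N
    ƛ-body : ∀ {x A M M′} → Ctx R M M′ → Ctx R (ƛ[ x ∶ A ] M) (ƛ[ x ∶ A ] M′)
    ƛ-ann  : ∀ {x A A′ M} → Ctx R A A′ → Ctx R (ƛ[ x ∶ A ] M) (ƛ[ x ∶ A′ ] M)
    Π-cod  : ∀ {x A B B′} → Ctx R B B′ → Ctx R (Π[ x ∶ A ] B) (Π[ x ∶ A ] B′)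
    Π-dom  : ∀ {x A A′ B} → Ctx R A A′ → Ctx R (Π[ x ∶ A ] B) (Π[ x ∶ A′ ] B)
    ·-l    : ∀ {M M′ N} → Ctx R M M′ → Ctx R (M · N) (M′ · N)
    ·-r    : ∀ {M N N′} → Ctx R N N′ → Ctx R (M · N) (M · N′)

  data _▷β_ : Λ → Λ → Set where
    β : ∀ {x A M N} → ((ƛ[ x ∶ A ] M) · N) ▷β (M [ x ≔ N ])

  _→β_ : Λ → Λ → Set
  _→β_ = Ctx _▷β_

  data _α∪β_ : Λ → Λ → Set where
    α-step : ∀ {M N} → M ∼α N → M α∪β N
    β-step : ∀ {M N} → M →β N → M α∪β N

  _≃β_ : Λ → Λ → Set
  _≃β_ = EqClosure _α∪β_

  Context : Set
  Context = List (𝒱 × Λ)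

  _,,_∶_ : Context → 𝒱 → Λ → Context
  Γ ,, x ∶ A = (x , A) ∷ Γ

  dom : Context → List 𝒱
  dom = map Data.Product.proj₁

  data _ok : Context → Set
  data _⊢_∶_ : Context → Λ → Λ → Set

  data _ok where
    nil  : [] ok
    cons : ∀ {Γ x A s} → Γ ok → Γ ⊢ A ∶ c s → x ∉ dom Γ → (Γ ,, x ∶ A) ok

  data _⊢_∶_ where
    sort : ∀ {Γ s₁ s₂} → Γ ok → 𝒜 s₁ s₂ → Γ ⊢ c s₁ ∶ c s₂
    prod : ∀ {Γ x A B s₁ s₂ s₃} → Γ ⊢ A ∶ c s₁
         → (∀ y → y ∉ dom Γ → (Γ ,, y ∶ A) ⊢ B [ x ≔ v y ] ∶ c s₂)
         → ℛ s₁ s₂ s₃ → Γ ⊢ Π[ x ∶ A ] B ∶ c s₃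
    var  : ∀ {Γ x A} → Γ ok → (x , A) ∈ Γ → Γ ⊢ v x ∶ A
    abs  : ∀ {Γ x y A B M s₁ s₂ s₃} → Γ ⊢ A ∶ c s₁
         → (∀ z → z ∉ dom Γ → (Γ ,, z ∶ A) ⊢ B [ y ≔ v z ] ∶ c s₂)
         → (∀ z → z ∉ dom Γ → (Γ ,, z ∶ A) ⊢ M [ x ≔ v z ] ∶ B [ y ≔ v z ])
         → ℛ s₁ s₂ s₃ → Γ ⊢ ƛ[ x ∶ A ] M ∶ Π[ y ∶ A ] B
    app  : ∀ {Γ M N x A B s} → Γ ⊢ M ∶ Π[ x ∶ A ] B → Γ ⊢ N ∶ A
         → Γ ⊢ B [ x ≔ N ] ∶ c s → Γ ⊢ M · N ∶ B [ x ≔ N ]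
    conv : ∀ {Γ M A B s} → Γ ⊢ M ∶ A → A ≃β B → Γ ⊢ B ∶ c s → Γ ⊢ M ∶ B

-- Capture-avoiding substitution _•_ renames every binder, so the syntactic equations one expects
-- (pushing σ under a binder that was opened at a fresh name, or through a β-redex) fail, but only
-- in the choice of bound names: they hold after a final ι-renaming. And ι-renaming is a canonical
-- form: M • ι ∼α M, alpha-equivalent terms have equal substitution instances, and typing is
-- invariant under replacing subject and type by terms with the same ι-renaming. With these, the
-- usual induction on derivations shows that every well-typed substitution preserves typing; the
-- theorem is the case (ι , x ≔ N).
module Submission where

open import Data.List using (List; []; _∷_; _++_; map; concat; concatMap)
open import Data.List.Properties
  using (++-identityʳ; concatMap-++; concatMap-cong; concatMap-pure; map-cong-local;
         filter-++; filter-all; filter-reject)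
open import Data.List.Membership.Propositional using (_∈_; _∉_)
open import Data.List.Membership.Propositional.Properties
  using (∈-++⁺ˡ; ∈-++⁺ʳ; ∈-++⁻; ∈-map⁺; ∈-map⁻; ∈-filter⁺; ∈-filter⁻; ∈-concatMap⁺)
open import Data.List.Relation.Unary.Any as Any using (here; there)
import Data.List.Relation.Unary.All as All
open import Data.List.Relation.Binary.Subset.Propositional using (_⊆_)
open import Data.List.Relation.Binary.Subset.Propositional.Properties using (∷⁺ʳ)
import Data.List.Relation.Binary.Subset.Propositional.Properties as ⊆
open import Data.Empty using (⊥-elim)
open import Data.Product using (_×_; _,_; proj₁; proj₂; ∃-syntax)
open import Data.Sum using (inj₁; inj₂)
open import Function using (_∘_)
open import Relation.Nullary using (¬?; yes; no)
open import Relation.Binary.PropositionalEquality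
  using (_≡_; _≢_; refl; sym; trans; cong; cong₂; subst; subst₂; module ≡-Reasoning)
open import Relation.Binary.Construct.Closure.Equivalence using (gmap; gfold; symmetric; isEquivalence)
open import Relation.Binary.Construct.Closure.ReflexiveTransitive using (ε; _◅_; _◅◅_)
open import Relation.Binary.Construct.Closure.Symmetric using (fwd)

open import Defs

concatMap-concatMap : ∀ {A B C : Set} (g : B → List C) (f : A → List B) xs →
  concatMap g (concatMap f xs) ≡ concatMap (concatMap g ∘ f) xs
concatMap-concatMap g f [] = refl
concatMap-concatMap g f (x ∷ xs) =
  trans (concatMap-++ g (f x) _) (cong (concatMap g (f x) ++_) (concatMap-concatMap g f xs))

module SubstitutionLemma (S : Setup) where
  open Setup S
  open PTS S

  ∉-minus : ∀ x xs → x ∉ xs - x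
  ∉-minus x xs x∈ = proj₂ (∈-filter⁻ (λ y → ¬? (y ≟ x)) {xs = xs} x∈) refl

  ∈-minus⁺ : ∀ {x y xs} → y ∈ xs → y ≢ x → y ∈ xs - x
  ∈-minus⁺ {x} = ∈-filter⁺ (λ y → ¬? (y ≟ x))

  ∈-minus⁻ : ∀ {x y xs} → y ∈ xs - x → y ∈ xs × y ≢ x
  ∈-minus⁻ {x} = ∈-filter⁻ (λ y → ¬? (y ≟ x))

  minus-++ : ∀ x xs ys → (xs ++ ys) - x ≡ (xs - x) ++ (ys - x)
  minus-++ x = filter-++ (λ y → ¬? (y ≟ x))

  minus-∉ : ∀ {x xs} → x ∉ xs → xs - x ≡ xs
  minus-∉ {x} {xs} x∉ =
    filter-all (λ y → ¬? (y ≟ x)) (All.tabulate λ y∈ y≡x → x∉ (subst (_∈ xs) y≡x y∈))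

  minus-∷ : ∀ x xs → (x ∷ xs) - x ≡ xs - x
  minus-∷ x xs = filter-reject (λ y → ¬? (y ≟ x)) (λ x≢x → x≢x refl)

  update-≡ : ∀ σ x N → (σ , x ≔ N) x ≡ N
  update-≡ σ x N with x ≟ x
  ... | yes _ = refl
  ... | no x≢x = ⊥-elim (x≢x refl)

  update-≢ : ∀ σ {x} N {y} → y ≢ x → (σ , x ≔ N) y ≡ σ y
  update-≢ σ {x} N {y} y≢x with y ≟ x
  ... | yes y≡x = ⊥-elim (y≢x y≡x)
  ... | no _ = refl

  update-agree : ∀ {σ τ} x N {xs} → (∀ {z} → z ∈ xs - x → σ z ≡ τ z) →
    ∀ {z} → z ∈ xs → (σ , x ≔ N) z ≡ (τ , x ≔ N) z
  update-agree x N σ≡τ {z} z∈ with z ≟ x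
  ... | yes _ = refl
  ... | no z≢x = σ≡τ (∈-minus⁺ z∈ z≢x)

  fvs : Σ′ → List 𝒱 → List 𝒱
  fvs σ = concatMap (λ y → fv (σ y))

  ∈-fvs⁺ : ∀ σ {xs y z} → z ∈ xs → y ∈ fv (σ z) → y ∈ fvs σ xs
  ∈-fvs⁺ σ z∈ y∈ = ∈-concatMap⁺ (λ y → fv (σ y)) (Any.map (λ { refl → y∈ }) z∈)

  fvs-ι : ∀ xs → fvs ι xs ≡ xs
  fvs-ι = concatMap-pure

  X′-fresh : ∀ xs → X′ xs ∉ xs
  X′-fresh xs x∈ =
    χ′-fresh (map encode xs) (subst (_∈ map encode xs) (encode-decode _) (∈-map⁺ encode x∈))

  X-fresh : ∀ σ xs → X σ xs ∉ fvs σ xs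
  X-fresh σ xs = X′-fresh (fvs σ xs)

  X-ι-fresh : ∀ xs → X ι xs ∉ xs
  X-ι-fresh xs = subst (X ι xs ∉_) (fvs-ι xs) (X-fresh ι xs)

  X-fresh-++ : ∀ σ xs ys → X σ (xs ++ ys) ∉ fvs σ xs × X σ (xs ++ ys) ∉ fvs σ ys
  X-fresh-++ σ xs ys = (λ w∈ → w∉ (∈-++⁺ˡ w∈)) , (λ w∈ → w∉ (∈-++⁺ʳ (fvs σ xs) w∈))
    where w∉ = subst (X σ (xs ++ ys) ∉_) (concatMap-++ _ xs ys) (X-fresh σ (xs ++ ys))

  X-cong : ∀ {σ τ} xs → (∀ {z} → z ∈ xs → σ z ≡ τ z) → X σ xs ≡ X τ xs
  X-cong xs σ≡τ = cong X′ (cong concat (map-cong-local (All.tabulate (cong fv ∘ σ≡τ))))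

  binder-≡ : ∀ (K : 𝒱 → Λ → Λ → Λ) {w w′ A A′} {f g : 𝒱 → Λ} →
    w ≡ w′ → A ≡ A′ → (∀ u → f u ≡ g u) → K w A (f w) ≡ K w′ A′ (g w′)
  binder-≡ K refl refl f≗g = cong (K _ _) (f≗g _)

  -- Substitution

  fvs-bind : ∀ σ x w xs → w ∉ fvs σ (xs - x) → fvs (σ , x ≔ v w) xs - w ≡ fvs σ (xs - x)
  fvs-bind σ x w [] w∉ = refl
  fvs-bind σ x w (z ∷ zs) w∉ with z ≟ x
  ... | yes refl = trans (minus-∷ w _) (fvs-bind σ z w zs w∉)
  ... | no _ = trans (minus-++ w (fv (σ z)) _)
                 (cong₂ _++_ (minus-∉ (w∉ ∘ ∈-++⁺ˡ)) (fvs-bind σ x w zs (w∉ ∘ ∈-++⁺ʳ (fv (σ z)))))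

  fv-•-binder : ∀ A M x σ {w} → w ∉ fvs σ (fv M - x) →
    fv (A • σ) ≡ fvs σ (fv A) → fv (M • (σ , x ≔ v w)) ≡ fvs (σ , x ≔ v w) (fv M) →
    fv (A • σ) ++ (fv (M • (σ , x ≔ v w)) - w) ≡ fvs σ (fv A ++ (fv M - x))
  fv-•-binder A M x σ {w} w∉ eA eM = begin
    fv (A • σ) ++ (fv (M • (σ , x ≔ v w)) - w)  ≡⟨ cong₂ _++_ eA (cong (_- w) eM) ⟩
    fvs σ (fv A) ++ (fvs (σ , x ≔ v w) (fv M) - w) ≡⟨ cong (fvs σ (fv A) ++_) (fvs-bind σ x w (fv M) w∉) ⟩
    fvs σ (fv A) ++ fvs σ (fv M - x)             ≡⟨ concatMap-++ _ (fv A) (fv M - x) ⟨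
    fvs σ (fv A ++ (fv M - x))                   ∎
    where open ≡-Reasoning

  fv-• : ∀ M σ → fv (M • σ) ≡ fvs σ (fv M)
  fv-• (c k) σ = refl
  fv-• (v x) σ = sym (++-identityʳ (fv (σ x)))
  fv-• (ƛ[ x ∶ A ] M) σ = fv-•-binder A M x σ (X-fresh σ (fv M - x)) (fv-• A σ) (fv-• M _)
  fv-• (Π[ x ∶ A ] B) σ = fv-•-binder A B x σ (X-fresh σ (fv B - x)) (fv-• A σ) (fv-• B _)
  fv-• (M · N) σ = trans (cong₂ _++_ (fv-• M σ) (fv-• N σ)) (sym (concatMap-++ _ (fv M) (fv N)))

  fv-bind : ∀ M x σ {w} → w ∉ fvs σ (fv M - x) → fv (M • (σ , x ≔ v w)) - w ≡ fvs σ (fv M - x)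
  fv-bind M x σ {w} w∉ = trans (cong (_- w) (fv-• M _)) (fvs-bind σ x w (fv M) w∉)

  ∈-fv-[≔] : ∀ {M x z} N → z ∈ fv M → z ≢ x → z ∈ fv (M [ x ≔ N ])
  ∈-fv-[≔] {M} {x} {z} N z∈ z≢x = subst (z ∈_) (sym (fv-• M (ι , x ≔ N)))
    (∈-fvs⁺ (ι , x ≔ N) z∈ (subst (λ t → z ∈ fv t) (sym (update-≢ ι N z≢x)) (here refl)))

  •-cong : ∀ M {σ τ} → (∀ {z} → z ∈ fv M → σ z ≡ τ z) → M • σ ≡ M • τ
  •-cong (c k) σ≡τ = refl
  •-cong (v x) σ≡τ = σ≡τ (here refl)
  •-cong (ƛ[ x ∶ A ] M) σ≡τ =
    binder-≡ ƛ[_∶_]_ (X-cong (fv M - x) (σ≡τ ∘ ∈-++⁺ʳ (fv A))) (•-cong A (σ≡τ ∘ ∈-++⁺ˡ))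
      (λ u → •-cong M (update-agree x (v u) (σ≡τ ∘ ∈-++⁺ʳ (fv A))))
  •-cong (Π[ x ∶ A ] B) σ≡τ =
    binder-≡ Π[_∶_]_ (X-cong (fv B - x) (σ≡τ ∘ ∈-++⁺ʳ (fv A))) (•-cong A (σ≡τ ∘ ∈-++⁺ˡ))
      (λ u → •-cong B (update-agree x (v u) (σ≡τ ∘ ∈-++⁺ʳ (fv A))))
  •-cong (M · N) σ≡τ = cong₂ _·_ (•-cong M (σ≡τ ∘ ∈-++⁺ˡ)) (•-cong N (σ≡τ ∘ ∈-++⁺ʳ (fv M)))

  •-fresh-update : ∀ M {σ w} N → w ∉ fv M → M • (σ , w ≔ N) ≡ M • σ
  •-fresh-update M {σ} N w∉ = •-cong M λ z∈ → update-≢ σ N λ { refl → w∉ z∈ }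

  infixl 6 _⨾_
  _⨾_ : Σ′ → Σ′ → Σ′
  (σ ⨾ τ) z = σ z • τ

  fvs-⨾ : ∀ σ τ xs → fvs τ (fvs σ xs) ≡ fvs (σ ⨾ τ) xs
  fvs-⨾ σ τ xs = trans (concatMap-concatMap _ _ xs) (concatMap-cong (λ z → sym (fv-• (σ z) τ)) xs)

  X-⨾ : ∀ M x σ τ → let w = X σ (fv M - x) in
    X τ (fv (M • (σ , x ≔ v w)) - w) ≡ X (σ ⨾ τ) (fv M - x)
  X-⨾ M x σ τ =
    cong X′ (trans (cong (fvs τ) (fv-bind M x σ (X-fresh σ (fv M - x)))) (fvs-⨾ σ τ (fv M - x)))

  ⨾-update : ∀ σ τ x {w} N {xs} → w ∉ fvs σ (xs - x) →
    ∀ {z} → z ∈ xs → ((σ , x ≔ v w) ⨾ (τ , w ≔ N)) z ≡ ((σ ⨾ τ) , x ≔ N) z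
  ⨾-update σ τ x {w} N w∉ {z} z∈ with z ≟ x
  ... | yes _ = update-≡ τ w N
  ... | no z≢x = •-fresh-update (σ z) N (w∉ ∘ ∈-fvs⁺ σ (∈-minus⁺ z∈ z≢x))

  •-assoc : ∀ M σ τ → (M • σ) • τ ≡ M • (σ ⨾ τ)
  •-⨾-update : ∀ M x σ τ {w} N → w ∉ fvs σ (fv M - x) →
    (M • (σ , x ≔ v w)) • (τ , w ≔ N) ≡ M • ((σ ⨾ τ) , x ≔ N)

  •-assoc (c k) σ τ = refl
  •-assoc (v x) σ τ = refl
  •-assoc (ƛ[ x ∶ A ] M) σ τ = binder-≡ ƛ[_∶_]_ (X-⨾ M x σ τ) (•-assoc A σ τ)
    (λ u → •-⨾-update M x σ τ (v u) (X-fresh σ (fv M - x)))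
  •-assoc (Π[ x ∶ A ] B) σ τ = binder-≡ Π[_∶_]_ (X-⨾ B x σ τ) (•-assoc A σ τ)
    (λ u → •-⨾-update B x σ τ (v u) (X-fresh σ (fv B - x)))
  •-assoc (M · N) σ τ = cong₂ _·_ (•-assoc M σ τ) (•-assoc N σ τ)

  •-⨾-update M x σ τ {w} N w∉ =
    trans (•-assoc M (σ , x ≔ v w) (τ , w ≔ N)) (•-cong M (⨾-update σ τ x N w∉))

  -- ι ⨾ σ is σ up to η, so this is •-⨾-update at ι.
  •-open : ∀ M x σ {y} N → y ∉ fv M - x → (M [ x ≔ v y ]) • (σ , y ≔ N) ≡ M • (σ , x ≔ N)
  •-open M x σ N y∉ = •-⨾-update M x ι σ N (subst (_ ∉_) (sym (fvs-ι _)) y∉)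

  [≔]-• : ∀ M x N σ → (M [ x ≔ N ]) • σ ≡ M • (σ , x ≔ (N • σ))
  [≔]-• M x N σ = trans (•-assoc M _ σ) (•-cong M single)
    where
    single : ∀ {z} → z ∈ fv M → ((ι , x ≔ N) ⨾ σ) z ≡ (σ , x ≔ (N • σ)) z
    single {z} _ with z ≟ x
    ... | yes _ = refl
    ... | no _ = refl

  -- Alpha-conversion

  fv-open : ∀ M x {y} → y ∉ fv M - x → fv (M [ x ≔ v y ]) - y ≡ fv M - x
  fv-open M x y∉ = trans (fv-bind M x ι (subst (_ ∉_) (sym (fvs-ι _)) y∉)) (fvs-ι _)

  module _ (M : Λ) (x : 𝒱) (M′ : Λ) (x′ : 𝒱) {y} (y∉ : y ∉ fv M - x) (y∉′ : y ∉ fv M′ - x′)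
           (opened : M [ x ≔ v y ] ≡ M′ [ x′ ≔ v y ]) where

    opening-X : ∀ σ → X σ (fv M - x) ≡ X σ (fv M′ - x′)
    opening-X σ = cong (X σ)
      (trans (sym (fv-open M x y∉)) (trans (cong (λ t → fv t - y) opened) (fv-open M′ x′ y∉′)))

    opening-• : ∀ σ N → M • (σ , x ≔ N) ≡ M′ • (σ , x′ ≔ N)
    opening-• σ N =
      trans (sym (•-open M x σ N y∉)) (trans (cong (_• (σ , y ≔ N)) opened) (•-open M′ x′ σ N y∉′))

  ∼α⇒•≡ : ∀ {M M′} → M ∼α M′ → ∀ σ → M • σ ≡ M′ • σ
  ∼α⇒•≡ ∼c σ = refl
  ∼α⇒•≡ ∼v σ = refl
  ∼α⇒•≡ (∼· M∼ N∼) σ = cong₂ _·_ (∼α⇒•≡ M∼ σ) (∼α⇒•≡ N∼ σ)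
  ∼α⇒•≡ (∼ƛ {x} {x′} {M = M} {M′} y A∼ y∉ y∉′ opened) σ = binder-≡ ƛ[_∶_]_
    (opening-X M x M′ x′ y∉ y∉′ opened σ) (∼α⇒•≡ A∼ σ) (opening-• M x M′ x′ y∉ y∉′ opened σ ∘ v)
  ∼α⇒•≡ (∼Π {x} {x′} {B = B} {B′} y A∼ y∉ y∉′ opened) σ = binder-≡ Π[_∶_]_
    (opening-X B x B′ x′ y∉ y∉′ opened σ) (∼α⇒•≡ A∼ σ) (opening-• B x B′ x′ y∉ y∉′ opened σ ∘ v)

  ∼α-refl : ∀ M → M ∼α M
  ∼α-refl (c k) = ∼c
  ∼α-refl (v x) = ∼v
  ∼α-refl (ƛ[ x ∶ A ] M) = ∼ƛ x (∼α-refl A) (∉-minus x (fv M)) (∉-minus x (fv M)) refl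
  ∼α-refl (Π[ x ∶ A ] B) = ∼Π x (∼α-refl A) (∉-minus x (fv B)) (∉-minus x (fv B)) refl
  ∼α-refl (M · N) = ∼· (∼α-refl M) (∼α-refl N)

  •ι-∼α : ∀ M → M • ι ∼α M
  •ι-∼α (c k) = ∼c
  •ι-∼α (v x) = ∼v
  •ι-∼α (ƛ[ x ∶ A ] M) = ∼ƛ w (•ι-∼α A) (∉-minus w (fv (M • (ι , x ≔ v w)))) (X-ι-fresh (fv M - x))
    (•-⨾-update M x ι ι (v w) (X-fresh ι (fv M - x)))
    where w = X ι (fv M - x)
  •ι-∼α (Π[ x ∶ A ] B) = ∼Π w (•ι-∼α A) (∉-minus w (fv (B • (ι , x ≔ v w)))) (X-ι-fresh (fv B - x))
    (•-⨾-update B x ι ι (v w) (X-fresh ι (fv B - x)))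
    where w = X ι (fv B - x)
  •ι-∼α (M · N) = ∼· (•ι-∼α M) (•ι-∼α N)

  -- Renaming a bound variable to any fresh w is an alpha-step.
  rename-bound : ∀ M x σ {w} → w ∉ fvs σ (fv M - x) → let y = X σ (fv M - x) in
    (M • (σ , x ≔ v y)) [ y ≔ v w ] ≡ (M • (σ , x ≔ v w)) [ w ≔ v w ]
  rename-bound M x σ {w} w∉ =
    trans (•-⨾-update M x σ ι (v w) (X-fresh σ (fv M - x))) (sym (•-⨾-update M x σ ι (v w) w∉))

  •-ƛ-∼α : ∀ x A M σ {w} → w ∉ fvs σ (fv M - x) →
    (ƛ[ x ∶ A ] M) • σ ∼α ƛ[ w ∶ A • σ ] (M • (σ , x ≔ v w))
  •-ƛ-∼α x A M σ {w} w∉ = ∼ƛ w (∼α-refl _) (subst (w ∉_) (sym (fv-bind M x σ (X-fresh σ (fv M - x)))) w∉)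
    (∉-minus w (fv (M • (σ , x ≔ v w)))) (rename-bound M x σ w∉)

  •-Π-∼α : ∀ x A B σ {w} → w ∉ fvs σ (fv B - x) →
    (Π[ x ∶ A ] B) • σ ∼α Π[ w ∶ A • σ ] (B • (σ , x ≔ v w))
  •-Π-∼α x A B σ {w} w∉ = ∼Π w (∼α-refl _) (subst (w ∉_) (sym (fv-bind B x σ (X-fresh σ (fv B - x)))) w∉)
    (∉-minus w (fv (B • (σ , x ≔ v w)))) (rename-bound B x σ w∉)

  -- ι-renaming

  -- A record rather than an equation, so that both sides stay inferable.
  infix 4 _≡ι_
  record _≡ι_ (M N : Λ) : Set where
    constructor mk≡ι
    field •ι-≡ : M • ι ≡ N • ι
  open _≡ι_

  ≡ι-refl : ∀ {M} → M ≡ι M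
  ≡ι-refl = mk≡ι refl

  ≡ι-sym : ∀ {M N} → M ≡ι N → N ≡ι M
  ≡ι-sym (mk≡ι e) = mk≡ι (sym e)

  ≡ι-trans : ∀ {M N P} → M ≡ι N → N ≡ι P → M ≡ι P
  ≡ι-trans (mk≡ι e) (mk≡ι e′) = mk≡ι (trans e e′)

  ≡⇒≡ι : ∀ {M N} → M ≡ N → M ≡ι N
  ≡⇒≡ι refl = ≡ι-refl

  •ι-≡ι : ∀ M → M • ι ≡ι M
  •ι-≡ι M = mk≡ι (∼α⇒•≡ (•ι-∼α M) ι)

  •-cong-≡ι : ∀ M {σ τ} → (∀ {z} → z ∈ fv M → σ z ≡ι τ z) → M • σ ≡ι M • τ
  •-cong-≡ι M {σ} {τ} σ≡τ = mk≡ι (begin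
    (M • σ) • ι  ≡⟨ •-assoc M σ ι ⟩
    M • (σ ⨾ ι)  ≡⟨ •-cong M (•ι-≡ ∘ σ≡τ) ⟩
    M • (τ ⨾ ι)  ≡⟨ •-assoc M τ ι ⟨
    (M • τ) • ι  ∎)
    where open ≡-Reasoning

  update-≡ι : ∀ {σ τ} x {N N′} → N ≡ι N′ → (∀ z → σ z ≡ι τ z) →
    ∀ z → (σ , x ≔ N) z ≡ι (τ , x ≔ N′) z
  update-≡ι x N≡N′ σ≡τ z with z ≟ x
  ... | yes _ = N≡N′
  ... | no _ = σ≡τ z

  [≔]-≡ι : ∀ M x {N N′} → N ≡ι N′ → M [ x ≔ N ] ≡ι M [ x ≔ N′ ]
  [≔]-≡ι M x N≡N′ = •-cong-≡ι M (λ {z} _ → update-≡ι x N≡N′ (λ _ → ≡ι-refl) z)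

  •-instantiate-≡ι : ∀ M x σ N → let w = X σ (fv M - x) in
    (M • (σ , x ≔ v w)) [ w ≔ N ] ≡ι M • (σ , x ≔ N)
  •-instantiate-≡ι M x σ N = ≡ι-trans (≡⇒≡ι (•-⨾-update M x σ ι N (X-fresh σ (fv M - x))))
    (•-cong-≡ι M (λ {z} _ → update-≡ι x ≡ι-refl (•ι-≡ι ∘ σ) z))

  •-β : ∀ M x N σ → let w = X σ (fv M - x) in
    (M • (σ , x ≔ v w)) [ w ≔ N • σ ] ≡ι (M [ x ≔ N ]) • σ
  •-β M x N σ = ≡ι-trans (•-instantiate-≡ι M x σ (N • σ)) (≡⇒≡ι (sym ([≔]-• M x N σ)))

  •-reopen : ∀ M x σ {y} N → y ∉ fv M - x → let w = X σ (fv M - x) in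
    (M [ x ≔ v y ]) • (σ , y ≔ N) ≡ι (M • (σ , x ≔ v w)) [ w ≔ N ]
  •-reopen M x σ N y∉ = ≡ι-trans (≡⇒≡ι (•-open M x σ N y∉)) (≡ι-sym (•-instantiate-≡ι M x σ N))

  -- Conversion

  ≃β-sym : ∀ {M N} → M ≃β N → N ≃β M
  ≃β-sym = symmetric _α∪β_

  ∼α⇒≃β : ∀ {M N} → M ∼α N → M ≃β N
  ∼α⇒≃β M∼N = fwd (α-step M∼N) ◅ ε

  ≡ι⇒≃β : ∀ {M N} → M ≡ι N → M ≃β N
  ≡ι⇒≃β {M} {N} (mk≡ι e) =
    ≃β-sym (∼α⇒≃β (•ι-∼α M)) ◅◅ subst (_≃β N) (sym e) (∼α⇒≃β (•ι-∼α N))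

  ƛ-body-≃β : ∀ w T {P P′} → P ≃β P′ → ƛ[ w ∶ T ] P ≃β ƛ[ w ∶ T ] P′
  ƛ-body-≃β w T = gmap (ƛ[ w ∶ T ]_) λ where
    (α-step {P} {P′} P∼) →
      α-step (∼ƛ w (∼α-refl T) (∉-minus w (fv P)) (∉-minus w (fv P′)) (∼α⇒•≡ P∼ (ι , w ≔ v w)))
    (β-step P→) → β-step (ƛ-body P→)

  Π-cod-≃β : ∀ w T {P P′} → P ≃β P′ → Π[ w ∶ T ] P ≃β Π[ w ∶ T ] P′
  Π-cod-≃β w T = gmap (Π[ w ∶ T ]_) λ where
    (α-step {P} {P′} P∼) →
      α-step (∼Π w (∼α-refl T) (∉-minus w (fv P)) (∉-minus w (fv P′)) (∼α⇒•≡ P∼ (ι , w ≔ v w)))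
    (β-step P→) → β-step (Π-cod P→)

  ƛ-ann-≃β : ∀ w P {T T′} → T ≃β T′ → ƛ[ w ∶ T ] P ≃β ƛ[ w ∶ T′ ] P
  ƛ-ann-≃β w P = gmap (λ T → ƛ[ w ∶ T ] P) λ where
    (α-step T∼) → α-step (∼ƛ w T∼ (∉-minus w (fv P)) (∉-minus w (fv P)) refl)
    (β-step T→) → β-step (ƛ-ann T→)

  Π-dom-≃β : ∀ w P {T T′} → T ≃β T′ → Π[ w ∶ T ] P ≃β Π[ w ∶ T′ ] P
  Π-dom-≃β w P = gmap (λ T → Π[ w ∶ T ] P) λ where
    (α-step T∼) → α-step (∼Π w T∼ (∉-minus w (fv P)) (∉-minus w (fv P)) refl)
    (β-step T→) → β-step (Π-dom T→)

  ·ˡ-≃β : ∀ N {M M′} → M ≃β M′ → M · N ≃β M′ · N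
  ·ˡ-≃β N = gmap (_· N) λ where
    (α-step M∼) → α-step (∼· M∼ (∼α-refl N))
    (β-step M→) → β-step (·-l M→)

  ·ʳ-≃β : ∀ M {N N′} → N ≃β N′ → M · N ≃β M · N′
  ·ʳ-≃β M = gmap (M ·_) λ where
    (α-step N∼) → α-step (∼· (∼α-refl M) N∼)
    (β-step N→) → β-step (·-r N→)

  •-→β : ∀ {A B} → A →β B → ∀ σ → A • σ ≃β B • σ
  •-→β (base (β {x} {A} {M} {N})) σ = fwd (β-step (base β)) ◅ ≡ι⇒≃β (•-β M x N σ)
  •-→β (ƛ-body {x} {A} {M} {M′} M→) σ =
    ∼α⇒≃β (•-ƛ-∼α x A M σ (proj₁ w∉)) ◅◅ ƛ-body-≃β _ (A • σ) (•-→β M→ _)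
      ◅◅ ≃β-sym (∼α⇒≃β (•-ƛ-∼α x A M′ σ (proj₂ w∉)))
    where w∉ = X-fresh-++ σ (fv M - x) (fv M′ - x)
  •-→β (Π-cod {x} {A} {B} {B′} B→) σ =
    ∼α⇒≃β (•-Π-∼α x A B σ (proj₁ w∉)) ◅◅ Π-cod-≃β _ (A • σ) (•-→β B→ _)
      ◅◅ ≃β-sym (∼α⇒≃β (•-Π-∼α x A B′ σ (proj₂ w∉)))
    where w∉ = X-fresh-++ σ (fv B - x) (fv B′ - x)
  •-→β (ƛ-ann A→) σ = ƛ-ann-≃β _ _ (•-→β A→ σ)
  •-→β (Π-dom A→) σ = Π-dom-≃β _ _ (•-→β A→ σ)
  •-→β (·-l {N = N} M→) σ = ·ˡ-≃β (N • σ) (•-→β M→ σ)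
  •-→β (·-r {M} N→) σ = ·ʳ-≃β (M • σ) (•-→β N→ σ)

  •-≃β : ∀ σ {A B} → A ≃β B → A • σ ≃β B • σ
  •-≃β σ = gfold (isEquivalence _α∪β_) (_• σ) λ where
    (α-step A∼) → subst (_ ≃β_) (∼α⇒•≡ A∼ σ) ε
    (β-step A→) → •-→β A→ σ

  -- Structural properties of typing

  ⊢⇒ok : ∀ {Γ M B} → Γ ⊢ M ∶ B → Γ ok
  ⊢⇒ok (sort ⊢Γ _) = ⊢Γ
  ⊢⇒ok (prod ⊢A _ _) = ⊢⇒ok ⊢A
  ⊢⇒ok (var ⊢Γ _) = ⊢Γ
  ⊢⇒ok (abs ⊢A _ _ _) = ⊢⇒ok ⊢A
  ⊢⇒ok (app ⊢M _ _) = ⊢⇒ok ⊢M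
  ⊢⇒ok (conv ⊢M _ _) = ⊢⇒ok ⊢M

  ∈⇒∈dom : ∀ {Γ z T} → (z , T) ∈ Γ → z ∈ dom Γ
  ∈⇒∈dom = ∈-map⁺ proj₁

  weaken : ∀ {Γ Δ M B} → Γ ⊢ M ∶ B → Γ ⊆ Δ → Δ ok → Δ ⊢ M ∶ B
  weaken (sort _ ax) Γ⊆Δ ⊢Δ = sort ⊢Δ ax
  weaken (var _ z∈) Γ⊆Δ ⊢Δ = var ⊢Δ (Γ⊆Δ z∈)
  weaken (prod ⊢A ⊢B r) Γ⊆Δ ⊢Δ =
    prod ⊢A′ (λ y y∉ → weaken (⊢B y (y∉ ∘ ⊆.map⁺ proj₁ Γ⊆Δ)) (∷⁺ʳ _ Γ⊆Δ) (cons ⊢Δ ⊢A′ y∉)) r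
    where ⊢A′ = weaken ⊢A Γ⊆Δ ⊢Δ
  weaken (abs ⊢A ⊢B ⊢M r) Γ⊆Δ ⊢Δ =
    abs ⊢A′ (λ y y∉ → weaken (⊢B y (y∉ ∘ ⊆.map⁺ proj₁ Γ⊆Δ)) (∷⁺ʳ _ Γ⊆Δ) (cons ⊢Δ ⊢A′ y∉))
            (λ y y∉ → weaken (⊢M y (y∉ ∘ ⊆.map⁺ proj₁ Γ⊆Δ)) (∷⁺ʳ _ Γ⊆Δ) (cons ⊢Δ ⊢A′ y∉)) r
    where ⊢A′ = weaken ⊢A Γ⊆Δ ⊢Δ
  weaken (app ⊢M ⊢N ⊢B) Γ⊆Δ ⊢Δ = app (weaken ⊢M Γ⊆Δ ⊢Δ) (weaken ⊢N Γ⊆Δ ⊢Δ) (weaken ⊢B Γ⊆Δ ⊢Δ)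
  weaken (conv ⊢M A≃B ⊢B) Γ⊆Δ ⊢Δ = conv (weaken ⊢M Γ⊆Δ ⊢Δ) A≃B (weaken ⊢B Γ⊆Δ ⊢Δ)

  -- The premise is instantiated at a name fresh for both z and Γ.
  fv-binder⊆dom : ∀ {Γ} B x → (∀ y → y ∉ dom Γ → fv (B [ x ≔ v y ]) ⊆ y ∷ dom Γ) → fv B - x ⊆ dom Γ
  fv-binder⊆dom {Γ} B x h {z} z∈ with ∈-minus⁻ {xs = fv B} z∈
  ... | z∈B , z≢x with h (X′ (z ∷ dom Γ)) (X′-fresh (z ∷ dom Γ) ∘ there)
                         (∈-fv-[≔] {B} (v (X′ (z ∷ dom Γ))) z∈B z≢x)
  ... | here z≡y = ⊥-elim (X′-fresh (z ∷ dom Γ) (here (sym z≡y)))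
  ... | there z∈Γ = z∈Γ

  fv⊆dom : ∀ {Γ M B} → Γ ⊢ M ∶ B → fv M ⊆ dom Γ
  fv⊆dom (sort _ _) ()
  fv⊆dom (var _ x∈) (here refl) = ∈⇒∈dom x∈
  fv⊆dom (prod {x = x} {A} {B} ⊢A ⊢B _) z∈ with ∈-++⁻ (fv A) z∈
  ... | inj₁ z∈A = fv⊆dom ⊢A z∈A
  ... | inj₂ z∈B = fv-binder⊆dom B x (λ y y∉ → fv⊆dom (⊢B y y∉)) z∈B
  fv⊆dom (abs {x = x} {A = A} {M = M} ⊢A _ ⊢M _) z∈ with ∈-++⁻ (fv A) z∈
  ... | inj₁ z∈A = fv⊆dom ⊢A z∈A
  ... | inj₂ z∈M = fv-binder⊆dom M x (λ y y∉ → fv⊆dom (⊢M y y∉)) z∈M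
  fv⊆dom (app {M = M} ⊢M ⊢N _) z∈ with ∈-++⁻ (fv M) z∈
  ... | inj₁ z∈M = fv⊆dom ⊢M z∈M
  ... | inj₂ z∈N = fv⊆dom ⊢N z∈N
  fv⊆dom (conv ⊢M _ _) z∈ = fv⊆dom ⊢M z∈

  ok⇒sorted : ∀ {Γ z T} → Γ ok → (z , T) ∈ Γ → ∃[ s ] Γ ⊢ T ∶ c s
  ok⇒sorted (cons ⊢Γ ⊢A x∉) (here refl) = _ , weaken ⊢A there (cons ⊢Γ ⊢A x∉)
  ok⇒sorted (cons ⊢Γ ⊢A x∉) (there z∈) = _ , weaken (proj₂ (ok⇒sorted ⊢Γ z∈)) there (cons ⊢Γ ⊢A x∉)

  ok⇒fresh : ∀ {Γ z T y} → Γ ok → (z , T) ∈ Γ → y ∉ dom Γ → y ∉ fv T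
  ok⇒fresh ⊢Γ z∈ y∉ = y∉ ∘ fv⊆dom (proj₂ (ok⇒sorted ⊢Γ z∈))

  infix 4 _⊩_
  _⊩_ : Context → Context → Set
  Δ ⊩ Γ = ∀ {z T} → (z , T) ∈ Γ → Δ ⊢ v z ∶ T

  ⊩-dom : ∀ {Γ Δ y} → Δ ⊩ Γ → y ∉ dom Δ → y ∉ dom Γ
  ⊩-dom Δ⊩Γ y∉ y∈ with ∈-map⁻ proj₁ y∈
  ... | _ , z∈ , refl = y∉ (fv⊆dom (Δ⊩Γ z∈) (here refl))

  ⊩-extend : ∀ {Γ Δ y A} → Δ ⊩ Γ → (Δ ,, y ∶ A) ok → (Δ ,, y ∶ A) ⊩ (Γ ,, y ∶ A)
  ⊩-extend Δ⊩Γ ⊢Δy (here refl) = var ⊢Δy (here refl)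
  ⊩-extend Δ⊩Γ ⊢Δy (there z∈) = weaken (Δ⊩Γ z∈) there ⊢Δy

  ⊩-⊢ : ∀ {Γ Δ M B} → Δ ⊩ Γ → Δ ok → Γ ⊢ M ∶ B → Δ ⊢ M ∶ B
  ⊩-⊢ Δ⊩Γ ⊢Δ (sort _ ax) = sort ⊢Δ ax
  ⊩-⊢ Δ⊩Γ ⊢Δ (var _ z∈) = Δ⊩Γ z∈
  ⊩-⊢ {Γ} {Δ} Δ⊩Γ ⊢Δ (prod {A = A} ⊢A ⊢B r) = prod ⊢A′ (λ y y∉ → under y∉ (⊢B y (⊩-dom Δ⊩Γ y∉))) r
    where
    ⊢A′ = ⊩-⊢ Δ⊩Γ ⊢Δ ⊢A
    under : ∀ {y P T} → y ∉ dom Δ → (Γ ,, y ∶ A) ⊢ P ∶ T → (Δ ,, y ∶ A) ⊢ P ∶ T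
    under y∉ = ⊩-⊢ (⊩-extend Δ⊩Γ (cons ⊢Δ ⊢A′ y∉)) (cons ⊢Δ ⊢A′ y∉)
  ⊩-⊢ {Γ} {Δ} Δ⊩Γ ⊢Δ (abs {A = A} ⊢A ⊢B ⊢M r) =
    abs ⊢A′ (λ y y∉ → under y∉ (⊢B y (⊩-dom Δ⊩Γ y∉))) (λ y y∉ → under y∉ (⊢M y (⊩-dom Δ⊩Γ y∉))) r
    where
    ⊢A′ = ⊩-⊢ Δ⊩Γ ⊢Δ ⊢A
    under : ∀ {y P T} → y ∉ dom Δ → (Γ ,, y ∶ A) ⊢ P ∶ T → (Δ ,, y ∶ A) ⊢ P ∶ T
    under y∉ = ⊩-⊢ (⊩-extend Δ⊩Γ (cons ⊢Δ ⊢A′ y∉)) (cons ⊢Δ ⊢A′ y∉)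
  ⊩-⊢ Δ⊩Γ ⊢Δ (app ⊢M ⊢N ⊢B) = app (⊩-⊢ Δ⊩Γ ⊢Δ ⊢M) (⊩-⊢ Δ⊩Γ ⊢Δ ⊢N) (⊩-⊢ Δ⊩Γ ⊢Δ ⊢B)
  ⊩-⊢ Δ⊩Γ ⊢Δ (conv ⊢M A≃B ⊢B) = conv (⊩-⊢ Δ⊩Γ ⊢Δ ⊢M) A≃B (⊩-⊢ Δ⊩Γ ⊢Δ ⊢B)

  ⊢-head-≡ι : ∀ {Γ A A′ s s′ z M B} → Γ ⊢ A ∶ c s → Γ ⊢ A′ ∶ c s′ → A ≡ι A′ → z ∉ dom Γ →
    (Γ ,, z ∶ A) ⊢ M ∶ B → (Γ ,, z ∶ A′) ⊢ M ∶ B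
  ⊢-head-≡ι {Γ} {A} {A′} {z = z} ⊢A ⊢A′ A≡A′ z∉ = ⊩-⊢ head ⊢Γz
    where
    ⊢Γz = cons (⊢⇒ok ⊢A) ⊢A′ z∉
    head : (Γ ,, z ∶ A′) ⊩ (Γ ,, z ∶ A)
    head (here refl) = conv (var ⊢Γz (here refl)) (≡ι⇒≃β (≡ι-sym A≡A′)) (weaken ⊢A there ⊢Γz)
    head (there y∈) = var ⊢Γz (there y∈)

  -- Typing is invariant under ≡ι

  ƛ-injective : ∀ {x A M x′ A′ M′} → ƛ[ x ∶ A ] M ≡ ƛ[ x′ ∶ A′ ] M′ → x ≡ x′ × A ≡ A′ × M ≡ M′
  ƛ-injective refl = refl , refl , refl

  Π-injective : ∀ {x A B x′ A′ B′} → Π[ x ∶ A ] B ≡ Π[ x′ ∶ A′ ] B′ → x ≡ x′ × A ≡ A′ × B ≡ B′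
  Π-injective refl = refl , refl , refl

  ·-injective : ∀ {M N M′ N′} → M · N ≡ M′ · N′ → M ≡ M′ × N ≡ N′
  ·-injective refl = refl , refl

  -- ι-renaming names the binder after the body, so equal renamings have equal openings.
  opening-≡ : ∀ M x M′ x′ → X ι (fv M - x) ≡ X ι (fv M′ - x′) →
    M • (ι , x ≔ v (X ι (fv M - x))) ≡ M′ • (ι , x′ ≔ v (X ι (fv M′ - x′))) →
    ∀ y → M [ x ≔ v y ] ≡ M′ [ x′ ≔ v y ]
  opening-≡ M x M′ x′ w≡w′ body≡ y = begin
    M [ x ≔ v y ]                     ≡⟨ •-⨾-update M x ι ι (v y) (X-fresh ι (fv M - x)) ⟨
    (M • (ι , x ≔ v w)) [ w ≔ v y ]    ≡⟨ cong₂ (λ u P → P [ u ≔ v y ]) w≡w′ body≡ ⟩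
    (M′ • (ι , x′ ≔ v w′)) [ w′ ≔ v y ] ≡⟨ •-⨾-update M′ x′ ι ι (v y) (X-fresh ι (fv M′ - x′)) ⟩
    M′ [ x′ ≔ v y ]                   ∎
    where
    open ≡-Reasoning
    w = X ι (fv M - x)
    w′ = X ι (fv M′ - x′)

  ≡ι-c⁻ : ∀ {k P} → c k ≡ι P → P ≡ c k
  ≡ι-c⁻ {P = c _} (mk≡ι refl) = refl
  ≡ι-c⁻ {P = v _} (mk≡ι ())
  ≡ι-c⁻ {P = ƛ[ _ ∶ _ ] _} (mk≡ι ())
  ≡ι-c⁻ {P = Π[ _ ∶ _ ] _} (mk≡ι ())
  ≡ι-c⁻ {P = _ · _} (mk≡ι ())

  ≡ι-v⁻ : ∀ {x P} → v x ≡ι P → P ≡ v x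
  ≡ι-v⁻ {P = c _} (mk≡ι ())
  ≡ι-v⁻ {P = v _} (mk≡ι refl) = refl
  ≡ι-v⁻ {P = ƛ[ _ ∶ _ ] _} (mk≡ι ())
  ≡ι-v⁻ {P = Π[ _ ∶ _ ] _} (mk≡ι ())
  ≡ι-v⁻ {P = _ · _} (mk≡ι ())

  ≡ι-ƛ⁻ : ∀ {x A M P} → ƛ[ x ∶ A ] M ≡ι P → ∃[ x′ ] ∃[ A′ ] ∃[ M′ ]
    P ≡ ƛ[ x′ ∶ A′ ] M′ × A ≡ι A′ × (∀ y → M [ x ≔ v y ] ≡ M′ [ x′ ≔ v y ])
  ≡ι-ƛ⁻ {P = c _} (mk≡ι ())
  ≡ι-ƛ⁻ {P = v _} (mk≡ι ())
  ≡ι-ƛ⁻ {x} {M = M} {ƛ[ x′ ∶ A′ ] M′} (mk≡ι e) with ƛ-injective e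
  ... | w≡w′ , A≡A′ , body≡ = x′ , A′ , M′ , refl , mk≡ι A≡A′ , opening-≡ M x M′ x′ w≡w′ body≡
  ≡ι-ƛ⁻ {P = Π[ _ ∶ _ ] _} (mk≡ι ())
  ≡ι-ƛ⁻ {P = _ · _} (mk≡ι ())

  ≡ι-Π⁻ : ∀ {x A B P} → Π[ x ∶ A ] B ≡ι P → ∃[ x′ ] ∃[ A′ ] ∃[ B′ ]
    P ≡ Π[ x′ ∶ A′ ] B′ × A ≡ι A′ × (∀ y → B [ x ≔ v y ] ≡ B′ [ x′ ≔ v y ])
  ≡ι-Π⁻ {P = c _} (mk≡ι ())
  ≡ι-Π⁻ {P = v _} (mk≡ι ())
  ≡ι-Π⁻ {P = ƛ[ _ ∶ _ ] _} (mk≡ι ())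
  ≡ι-Π⁻ {x} {B = B} {Π[ x′ ∶ A′ ] B′} (mk≡ι e) with Π-injective e
  ... | w≡w′ , A≡A′ , body≡ = x′ , A′ , B′ , refl , mk≡ι A≡A′ , opening-≡ B x B′ x′ w≡w′ body≡
  ≡ι-Π⁻ {P = _ · _} (mk≡ι ())

  ≡ι-·⁻ : ∀ {M N P} → M · N ≡ι P → ∃[ M′ ] ∃[ N′ ] P ≡ M′ · N′ × M ≡ι M′ × N ≡ι N′
  ≡ι-·⁻ {P = c _} (mk≡ι ())
  ≡ι-·⁻ {P = v _} (mk≡ι ())
  ≡ι-·⁻ {P = ƛ[ _ ∶ _ ] _} (mk≡ι ())
  ≡ι-·⁻ {P = Π[ _ ∶ _ ] _} (mk≡ι ())
  ≡ι-·⁻ {P = M′ · N′} (mk≡ι e) with ·-injective e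
  ... | M≡M′ , N≡N′ = M′ , N′ , refl , mk≡ι M≡M′ , mk≡ι N≡N′

  Π-dom-≡ι : ∀ x B {A A′} → A ≡ι A′ → Π[ x ∶ A ] B ≡ι Π[ x ∶ A′ ] B
  Π-dom-≡ι x B (mk≡ι e) = mk≡ι (cong (λ T → Π[ X ι (fv B - x) ∶ T ] (B • (ι , x ≔ v (X ι (fv B - x))))) e)

  prod-≡ι : ∀ {Γ x x′ A A′ B B′ s₁ s₂ s₃} → Γ ⊢ A ∶ c s₁ → Γ ⊢ A′ ∶ c s₁ → A ≡ι A′ →
    (∀ y → y ∉ dom Γ → (Γ ,, y ∶ A) ⊢ B [ x ≔ v y ] ∶ c s₂) → ℛ s₁ s₂ s₃ →
    (∀ y → B [ x ≔ v y ] ≡ B′ [ x′ ≔ v y ]) → Γ ⊢ Π[ x′ ∶ A′ ] B′ ∶ c s₃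
  prod-≡ι {Γ} {A = A} {s₂ = s₂} ⊢A ⊢A′ A≡A′ ⊢B r B≡B′ = prod ⊢A′ (λ y y∉ →
    ⊢-head-≡ι ⊢A ⊢A′ A≡A′ y∉ (subst (λ t → (Γ ,, y ∶ A) ⊢ t ∶ c s₂) (B≡B′ y) (⊢B y y∉))) r

  ⊢-≡ι : ∀ {Γ M B M′ B′} → Γ ⊢ M ∶ B → M ≡ι M′ → B ≡ι B′ → Γ ⊢ M′ ∶ B′
  ∈-≡ι : ∀ {Γ x A A′} → Γ ok → (x , A) ∈ Γ → A ≡ι A′ → Γ ⊢ v x ∶ A′

  ⊢-≡ι (sort ⊢Γ ax) M≡ B≡ with ≡ι-c⁻ M≡ | ≡ι-c⁻ B≡
  ... | refl | refl = sort ⊢Γ ax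
  ⊢-≡ι (prod {x = x} {B = B} ⊢A ⊢B r) M≡ B≡ with ≡ι-Π⁻ M≡ | ≡ι-c⁻ B≡
  ... | _ , _ , _ , refl , A≡A′ , cod≡ | refl =
    prod-≡ι {x = x} {B = B} ⊢A (⊢-≡ι ⊢A A≡A′ ≡ι-refl) A≡A′ ⊢B r cod≡
  ⊢-≡ι (var ⊢Γ x∈) M≡ B≡ with ≡ι-v⁻ M≡
  ... | refl = ∈-≡ι ⊢Γ x∈ B≡
  ⊢-≡ι {Γ} (abs {y = y} {A} {B} {s₁ = s₁} {s₂} ⊢A ⊢B ⊢M r) M≡ B≡ with ≡ι-ƛ⁻ M≡ | ≡ι-Π⁻ B≡
  ... | x′ , A′ , M₁ , refl , A≡A′ , body≡ | y′ , A″ , B₁ , refl , A≡A″ , cod≡ =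
    conv (abs ⊢A′ ⊢B₁ ⊢M₁ r) (≡ι⇒≃β (Π-dom-≡ι y′ B₁ (≡ι-trans (≡ι-sym A≡A′) A≡A″)))
         (prod-≡ι {x = y} {B = B} ⊢A (⊢-≡ι ⊢A A≡A″ ≡ι-refl) A≡A″ ⊢B r cod≡)
    where
    ⊢A′ : Γ ⊢ A′ ∶ c s₁
    ⊢A′ = ⊢-≡ι ⊢A A≡A′ ≡ι-refl
    ⊢B₁ : ∀ z → z ∉ dom Γ → (Γ ,, z ∶ A′) ⊢ B₁ [ y′ ≔ v z ] ∶ c s₂
    ⊢B₁ z z∉ = ⊢-head-≡ι ⊢A ⊢A′ A≡A′ z∉ (subst (λ t → (Γ ,, z ∶ A) ⊢ t ∶ c s₂) (cod≡ z) (⊢B z z∉))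
    ⊢M₁ : ∀ z → z ∉ dom Γ → (Γ ,, z ∶ A′) ⊢ M₁ [ x′ ≔ v z ] ∶ B₁ [ y′ ≔ v z ]
    ⊢M₁ z z∉ = ⊢-head-≡ι ⊢A ⊢A′ A≡A′ z∉ (subst₂ ((Γ ,, z ∶ A) ⊢_∶_) (body≡ z) (cod≡ z) (⊢M z z∉))
  ⊢-≡ι (app {x = x} {B = B} ⊢M ⊢N ⊢B) P≡ B≡ with ≡ι-·⁻ P≡
  ... | _ , _ , refl , M≡ , N≡ =
    conv (app (⊢-≡ι ⊢M M≡ ≡ι-refl) (⊢-≡ι ⊢N N≡ ≡ι-refl) (⊢-≡ι ⊢B B[N]≡ ≡ι-refl))
         (≡ι⇒≃β (≡ι-trans (≡ι-sym B[N]≡) B≡)) (⊢-≡ι ⊢B B≡ ≡ι-refl)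
    where B[N]≡ = [≔]-≡ι B x N≡
  ⊢-≡ι (conv ⊢M A≃B ⊢B) M≡ B≡ = conv (⊢-≡ι ⊢M M≡ ≡ι-refl) (A≃B ◅◅ ≡ι⇒≃β B≡) (⊢-≡ι ⊢B B≡ ≡ι-refl)

  ∈-≡ι (cons ⊢Γ ⊢A x∉) (here refl) A≡ =
    conv (var ⊢Γx (here refl)) (≡ι⇒≃β A≡) (weaken (⊢-≡ι ⊢A A≡ ≡ι-refl) there ⊢Γx)
    where ⊢Γx = cons ⊢Γ ⊢A x∉
  ∈-≡ι (cons ⊢Γ ⊢A x∉) (there x∈) A≡ = weaken (∈-≡ι ⊢Γ x∈ A≡) there (cons ⊢Γ ⊢A x∉)

  infix 4 _⊢ˢ_∶_
  _⊢ˢ_∶_ : Context → Σ′ → Context → Set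
  Δ ⊢ˢ σ ∶ Γ = ∀ {z T} → (z , T) ∈ Γ → Δ ⊢ σ z ∶ T • σ

  ⊢ˢ-ι : ∀ {Γ} → Γ ok → Γ ⊢ˢ ι ∶ Γ
  ⊢ˢ-ι ⊢Γ {T = T} z∈ = ⊢-≡ι (var ⊢Γ z∈) ≡ι-refl (≡ι-sym (•ι-≡ι T))

  ⊢ˢ-extend : ∀ {Γ Δ σ y A N} → Γ ok → y ∉ dom Γ → y ∉ fv A → Δ ⊢ˢ σ ∶ Γ → Δ ⊢ N ∶ A • σ →
    Δ ⊢ˢ (σ , y ≔ N) ∶ (Γ ,, y ∶ A)
  ⊢ˢ-extend {Δ = Δ} {σ} {y} {A} {N} ⊢Γ y∉Γ y∉A ⊢σ ⊢N (here refl) =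
    subst₂ (Δ ⊢_∶_) (sym (update-≡ σ y N)) (sym (•-fresh-update A N y∉A)) ⊢N
  ⊢ˢ-extend {Δ = Δ} {σ} {N = N} ⊢Γ y∉Γ y∉A ⊢σ ⊢N {T = T} (there z∈) =
    subst₂ (Δ ⊢_∶_) (sym (update-≢ σ N λ { refl → y∉Γ (∈⇒∈dom z∈) }))
      (sym (•-fresh-update T N (ok⇒fresh ⊢Γ z∈ y∉Γ))) (⊢σ z∈)

  ⊢ˢ-lift : ∀ {Γ Δ σ y u A s} → Γ ⊢ A ∶ c s → y ∉ dom Γ → Δ ⊢ˢ σ ∶ Γ →
    (Δ ,, u ∶ A • σ) ok → (Δ ,, u ∶ A • σ) ⊢ˢ (σ , y ≔ v u) ∶ (Γ ,, y ∶ A)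
  ⊢ˢ-lift ⊢A y∉ ⊢σ ⊢Δu =
    ⊢ˢ-extend (⊢⇒ok ⊢A) y∉ (y∉ ∘ fv⊆dom ⊢A) (λ z∈ → weaken (⊢σ z∈) there ⊢Δu) (var ⊢Δu (here refl))

  -- The premises about a bound variable are used at the name X′ (dom Γ), which is fresh for Γ.
  ⊢-• : ∀ {Γ Δ M B σ} → Γ ⊢ M ∶ B → Δ ok → Δ ⊢ˢ σ ∶ Γ → Δ ⊢ M • σ ∶ B • σ
  ⊢-• (sort _ ax) ⊢Δ ⊢σ = sort ⊢Δ ax
  ⊢-• (var _ z∈) ⊢Δ ⊢σ = ⊢σ z∈
  ⊢-• {Γ} {Δ} {σ = σ} (prod {x = x} {A} {B} ⊢A ⊢B r) ⊢Δ ⊢σ = prod ⊢Aσ ⊢Bσ r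
    where
    ⊢Aσ = ⊢-• ⊢A ⊢Δ ⊢σ
    y = X′ (dom Γ)
    under : ∀ {u P T} → u ∉ dom Δ → (Γ ,, y ∶ A) ⊢ P ∶ T →
      (Δ ,, u ∶ A • σ) ⊢ P • (σ , y ≔ v u) ∶ T • (σ , y ≔ v u)
    under u∉ ⊢P = ⊢-• ⊢P (cons ⊢Δ ⊢Aσ u∉) (⊢ˢ-lift ⊢A (X′-fresh (dom Γ)) ⊢σ (cons ⊢Δ ⊢Aσ u∉))
    y∉B = X′-fresh (dom Γ) ∘ fv-binder⊆dom B x (λ z z∉ → fv⊆dom (⊢B z z∉))
    ⊢Bσ = λ u u∉ → ⊢-≡ι (under u∉ (⊢B y (X′-fresh (dom Γ)))) (•-reopen B x σ (v u) y∉B) ≡ι-refl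
  ⊢-• {Γ} {Δ} {σ = σ} (abs {x = x} {y₀} {A} {B} {M} ⊢A ⊢B ⊢M r) ⊢Δ ⊢σ = abs ⊢Aσ ⊢Bσ ⊢Mσ r
    where
    ⊢Aσ = ⊢-• ⊢A ⊢Δ ⊢σ
    y = X′ (dom Γ)
    under : ∀ {u P T} → u ∉ dom Δ → (Γ ,, y ∶ A) ⊢ P ∶ T →
      (Δ ,, u ∶ A • σ) ⊢ P • (σ , y ≔ v u) ∶ T • (σ , y ≔ v u)
    under u∉ ⊢P = ⊢-• ⊢P (cons ⊢Δ ⊢Aσ u∉) (⊢ˢ-lift ⊢A (X′-fresh (dom Γ)) ⊢σ (cons ⊢Δ ⊢Aσ u∉))
    B≡ = λ u → •-reopen B y₀ σ (v u) (X′-fresh (dom Γ) ∘ fv-binder⊆dom B y₀ (λ z z∉ → fv⊆dom (⊢B z z∉)))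
    M≡ = λ u → •-reopen M x σ (v u) (X′-fresh (dom Γ) ∘ fv-binder⊆dom M x (λ z z∉ → fv⊆dom (⊢M z z∉)))
    ⊢Bσ = λ u u∉ → ⊢-≡ι (under u∉ (⊢B y (X′-fresh (dom Γ)))) (B≡ u) ≡ι-refl
    ⊢Mσ = λ u u∉ → ⊢-≡ι (under u∉ (⊢M y (X′-fresh (dom Γ)))) (M≡ u) (B≡ u)
  ⊢-• {σ = σ} (app {N = N} {x = x} {B = B} ⊢M ⊢N ⊢B) ⊢Δ ⊢σ =
    ⊢-≡ι (app (⊢-• ⊢M ⊢Δ ⊢σ) (⊢-• ⊢N ⊢Δ ⊢σ) (⊢-≡ι (⊢-• ⊢B ⊢Δ ⊢σ) (≡ι-sym (•-β B x N σ)) ≡ι-refl))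
      ≡ι-refl (•-β B x N σ)
  ⊢-• {σ = σ} (conv ⊢M A≃B ⊢B) ⊢Δ ⊢σ = conv (⊢-• ⊢M ⊢Δ ⊢σ) (•-≃β σ A≃B) (⊢-• ⊢B ⊢Δ ⊢σ)

  ⊢ˢ-single : ∀ {Γ x A N s} → Γ ok → Γ ⊢ A ∶ c s → x ∉ dom Γ → Γ ⊢ N ∶ A →
    Γ ⊢ˢ (ι , x ≔ N) ∶ (Γ ,, x ∶ A)
  ⊢ˢ-single {A = A} {N} ⊢Γ ⊢A x∉ ⊢N =
    ⊢ˢ-extend ⊢Γ x∉ (x∉ ∘ fv⊆dom ⊢A) (⊢ˢ-ι ⊢Γ) (⊢-≡ι ⊢N ≡ι-refl (≡ι-sym (•ι-≡ι A)))

lemma22 : (S : Setup) → let open PTS S in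
    ∀ (Γ : Context) (M N A B : Λ) (x : Setup.𝒱 S) →
    (Γ ,, x ∶ A) ⊢ M ∶ B → Γ ⊢ N ∶ A →
    Γ ⊢ M [ x ≔ N ] ∶ B [ x ≔ N ]
lemma22 S Γ M N A B x ⊢M ⊢N = substitute (⊢⇒ok ⊢M)
  where
  open PTS S
  open SubstitutionLemma S
  substitute : (Γ ,, x ∶ A) ok → Γ ⊢ M [ x ≔ N ] ∶ B [ x ≔ N ]
  substitute (cons ⊢Γ ⊢A x∉) = ⊢-• ⊢M ⊢Γ (⊢ˢ-single ⊢Γ ⊢A x∉ ⊢N)
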